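{- Every degenerate class of finite graphs is set-defined.
   Context: A class is degenerate if for some $d$ every graph in it is $d$-degenerate (every subgraph has a vertex of degree at most $d$). A class is set-defined if it is contained in the class of finite graphs isomorphic to finite induced subgraphs of a graph with vertex set $\mathbb N^k$ whose adjacency between distinct tuples $\bar a,\bar b$ is $\phi(\bar a,\bar b)\vee\phi(\bar b,\bar a)$ for some parameter-free first-order formula $\phi$ in the language of pure equality. -}

module Defs where

open import Level using (Level; _⊔_) renaming (suc to lsuc; zero to lzero)
open import Data.Nat using (ℕ; zero; suc; _+_; _≤_)
open import Data.Bool using (Bool; true; false; _∧_)
open import Data.Fin using (Fin; zero; suc)
open import Data.Vec using (Vec; lookup; _++_)
open import Data.Product using (Σ; ∃; _×_; _,_)
open import Data.Sum using (_⊎_)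
open import Data.Unit using (⊤)
open import Data.Empty using (⊥)
open import Relation.Nullary using (¬_)
open import Relation.Binary.PropositionalEquality using (_≡_; _≢_)
open import Function.Bundles using (_⇔_)

record FinGraph : Set where
  field
    size  : ℕ
    adj   : Fin size → Fin size → Bool
    sym   : ∀ u v → adj u v ≡ adj v u
    irref : ∀ v → adj v v ≡ false
open FinGraph public

count : ∀ {n} → (Fin n → Bool) → ℕ
count {zero}  p = 0
count {suc n} p = b2n (p zero) + count (λ i → p (suc i))
  where
  b2n : Bool → ℕ
  b2n true  = 1
  b2n false = 0

-- A (not necessarily induced) subgraph of G: vertex subset and an
-- edge subset of G's edges with both endpoints in the vertex subset.
record Subgraph (G : FinGraph) : Set where
  field
    vert    : Fin (size G) → Bool
    edge    : Fin (size G) → Fin (size G) → Bool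
    edgeSym : ∀ u v → edge u v ≡ edge v u
    edgeAdj : ∀ u v → edge u v ≡ true → adj G u v ≡ true
    edgeL   : ∀ u v → edge u v ≡ true → vert u ≡ true
open Subgraph public

degIn : {G : FinGraph} → Subgraph G → Fin (size G) → ℕ
degIn H v = count (λ u → vert H u ∧ edge H v u)

Degenerate : ℕ → FinGraph → Set
Degenerate d G =
  (H : Subgraph G) → (∃ λ v → vert H v ≡ true) →
  ∃ λ v → (vert H v ≡ true) × (degIn H v ≤ d)

GraphClass : (ℓ : Level) → Set (lsuc ℓ)
GraphClass ℓ = FinGraph → Set ℓ

DegenerateClass : ∀ {ℓ} → GraphClass ℓ → Set ℓ
DegenerateClass C = ∃ λ d → ∀ G → C G → Degenerate d G

-- First-order formulas in the language of pure equality, with no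
-- parameters (constants); variables are de Bruijn indices Fin n.

data Formula : ℕ → Set where
  eq′   : ∀ {n} → Fin n → Fin n → Formula n
  tt′   : ∀ {n} → Formula n
  ff′   : ∀ {n} → Formula n
  not′  : ∀ {n} → Formula n → Formula n
  and′  : ∀ {n} → Formula n → Formula n → Formula n
  or′   : ∀ {n} → Formula n → Formula n → Formula n
  imp′  : ∀ {n} → Formula n → Formula n → Formula n
  ex′   : ∀ {n} → Formula (suc n) → Formula n
  all′  : ∀ {n} → Formula (suc n) → Formula n

extend : ∀ {n} → ℕ → (Fin n → ℕ) → Fin (suc n) → ℕ
extend a ρ zero    = a
extend a ρ (suc i) = ρ i

Sat : ∀ {n} → Formula n → (Fin n → ℕ) → Set
Sat (eq′ i j)   ρ = ρ i ≡ ρ j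
Sat tt′         ρ = ⊤
Sat ff′         ρ = ⊥
Sat (not′ φ)    ρ = ¬ Sat φ ρ
Sat (and′ φ ψ)  ρ = Sat φ ρ × Sat ψ ρ
Sat (or′ φ ψ)   ρ = Sat φ ρ ⊎ Sat ψ ρ
Sat (imp′ φ ψ)  ρ = Sat φ ρ → Sat ψ ρ
Sat (ex′ φ)     ρ = Σ ℕ λ a → Sat φ (extend a ρ)
Sat (all′ φ)    ρ = (a : ℕ) → Sat φ (extend a ρ)

-- φ(ā, b̄) for ā, b̄ ∈ ℕ^k  (free variables: first k = ā, next k = b̄)
SatPair : ∀ {k} → Formula (k + k) → Vec ℕ k → Vec ℕ k → Set
SatPair φ a b = Sat φ (lookup (a ++ b))

-- adjacency in the graph on ℕ^k defined by φ (for distinct tuples)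
AdjΦ : ∀ {k} → Formula (k + k) → Vec ℕ k → Vec ℕ k → Set
AdjΦ φ a b = SatPair φ a b ⊎ SatPair φ b a

EmbedsIn : ∀ {k} → Formula (k + k) → FinGraph → Set
EmbedsIn {k} φ G =
  Σ (Fin (size G) → Vec ℕ k) λ f →
    (∀ u v → f u ≡ f v → u ≡ v) ×
    (∀ u v → u ≢ v → (adj G u v ≡ true) ⇔ AdjΦ {k} φ (f u) (f v))

SetDefined : ∀ {ℓ} → GraphClass ℓ → Set ℓ
SetDefined C =
  Σ ℕ λ k → Σ (Formula (k + k)) λ φ → ∀ G → C G → EmbedsIn {k} φ G

module Submission where

-- A d-degenerate graph G can be oriented so that every vertex
-- has out-degree at most d: repeatedly remove a vertex v of degree ≤ d in
-- what is left, and orient the remaining edges at v away from v.  Given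
-- such an orientation, send a vertex v (numbered as a natural number) to
-- the tuple  (v, w₁, …, w_d)  of length d+1, where w₁ … w_d lists its
-- out-neighbours, padded with copies of v.  For tuples (a₀ … a_d) and
-- (b₀ … b_d) let φ say  a₀ ≠ b₀ ∧ ⋁ᵢ aᵢ₊₁ = b₀ ;  then φ(code u, code v)
-- holds exactly when v is an out-neighbour of u, so φ(ā,b̄) ∨ φ(b̄,ā)
-- recovers adjacency, and the code is injective because of its first
-- entry.

open import Defs hiding (sym)
open import Level using (Level)
open import Data.Nat using (ℕ; zero; suc; _+_; _≤_; z≤n; s≤s)
open import Data.Nat.Properties using (≤-refl; ≤-pred; ≤-reflexive; ≤-trans)
open import Data.Bool using (Bool; true; false; _∧_) renaming (_≟_ to _≟ᵇ_)
open import Data.Fin using (Fin; zero; suc; toℕ; _↑ˡ_; _↑ʳ_; _≟_)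
open import Data.Fin.Properties using (toℕ-injective; any?)
open import Data.Vec using (Vec; []; _∷_; lookup; head; _++_)
open import Data.Vec.Properties using (lookup-++ˡ; lookup-++ʳ)
open import Data.Vec.Functional using (updateAt)
open import Data.Vec.Functional.Properties using (updateAt-updates; updateAt-minimal)
open import Data.List using (List; []; _∷_; length; map)
open import Data.List.Properties using (length-map)
open import Data.List.Relation.Unary.Any using (here; there)
open import Data.List.Membership.Propositional using (_∈_)
open import Data.List.Membership.Propositional.Properties using (∈-map⁺; ∈-map⁻)
open import Data.Product using (∃; _×_; _,_; proj₁; proj₂)
open import Data.Sum using (_⊎_; inj₁; inj₂)
open import Data.Empty using (⊥-elim)
open import Relation.Nullary using (¬_; yes; no)
open import Relation.Binary.PropositionalEquality
  using (_≡_; _≢_; refl; sym; trans; cong; subst)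
open import Function using (const)
open import Function.Bundles using (_⇔_; mk⇔; Equivalence)

open Equivalence using (to; from)

∧-elim : ∀ {a b} → a ∧ b ≡ true → a ≡ true × b ≡ true
∧-elim {true} {true} refl = refl , refl

∧-intro : ∀ {a b} → a ≡ true → b ≡ true → a ∧ b ≡ true
∧-intro refl refl = refl

count-ext : ∀ {n} (p q : Fin n → Bool) → (∀ i → p i ≡ q i) → count p ≡ count q
count-ext {zero}  p q p≗q = refl
count-ext {suc n} p q p≗q with p zero | q zero | p≗q zero
... | true  | .true  | refl = cong suc (count-ext _ _ (λ i → p≗q (suc i)))
... | false | .false | refl = count-ext _ _ (λ i → p≗q (suc i))

delete : ∀ {n} → (Fin n → Bool) → Fin n → Fin n → Bool
delete p v = updateAt p v (const false)

delete-⊆ : ∀ {n} (p : Fin n → Bool) v u → delete p v u ≡ true → p u ≡ true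
delete-⊆ p v u e with u ≟ v
... | yes refl with () ← trans (sym (updateAt-updates u p)) e
... | no u≢v = trans (sym (updateAt-minimal u v p u≢v)) e

count-delete : ∀ {n} (p : Fin n → Bool) v → p v ≡ true → count p ≡ suc (count (delete p v))
count-delete p zero    pv rewrite pv = refl
count-delete p (suc v) pv with p zero
... | true  = cong suc (count-delete (λ i → p (suc i)) v pv)
... | false = count-delete (λ i → p (suc i)) v pv

support : ∀ {n} → (Fin n → Bool) → List (Fin n)
support {zero}  p = []
support {suc n} p with p zero
... | true  = zero ∷ map suc (support (λ i → p (suc i)))
... | false = map suc (support (λ i → p (suc i)))

length-support : ∀ {n} (p : Fin n → Bool) → length (support p) ≡ count p
length-support {zero}  p = refl
length-support {suc n} p with p zero
... | true  = cong suc (trans (length-map suc (support (λ i → p (suc i)))) (length-support (λ i → p (suc i))))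
... | false = trans (length-map suc (support (λ i → p (suc i)))) (length-support (λ i → p (suc i)))

∈-support⁺ : ∀ {n} (p : Fin n → Bool) u → p u ≡ true → u ∈ support p
∈-support⁺ {suc n} p zero    pu rewrite pu = here refl
∈-support⁺ {suc n} p (suc u) pu with p zero
... | true  = there (∈-map⁺ suc (∈-support⁺ (λ i → p (suc i)) u pu))
... | false = ∈-map⁺ suc (∈-support⁺ (λ i → p (suc i)) u pu)

∈-support⁻ : ∀ {n} (p : Fin n → Bool) u → u ∈ support p → p u ≡ true
∈-support⁻ {suc n} p u u∈ with p zero in p0
∈-support⁻ {suc n} p .zero (here refl) | true = p0
∈-support⁻ {suc n} p u (there u∈) | true with ∈-map⁻ suc u∈
... | w , w∈ , refl = ∈-support⁻ (λ i → p (suc i)) w w∈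
∈-support⁻ {suc n} p u u∈ | false with ∈-map⁻ suc u∈
... | w , w∈ , refl = ∈-support⁻ (λ i → p (suc i)) w w∈

record Orientation (G : FinGraph) (d : ℕ) (S : Fin (size G) → Bool) : Set where
  field
    out       : Fin (size G) → List (Fin (size G))
    out-small : ∀ v → length (out v) ≤ d
    out-adj   : ∀ v w → w ∈ out v → adj G v w ≡ true
    out-cover : ∀ u w → S u ≡ true → S w ≡ true → adj G u w ≡ true →
                w ∈ out u ⊎ u ∈ out w
open Orientation

module Peeling (G : FinGraph) (d : ℕ) where

  Vertex : Set
  Vertex = Fin (size G)

  induced : (Vertex → Bool) → Subgraph G
  induced S = record
    { vert    = S
    ; edge    = λ u w → S u ∧ (S w ∧ adj G u w)
    ; edgeSym = induced-sym
    ; edgeAdj = λ u w e → proj₂ (∧-elim {S w} (proj₂ (∧-elim {S u} e)))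
    ; edgeL   = λ u w e → proj₁ (∧-elim {S u} e)
    }
    where
    induced-sym : ∀ u w → S u ∧ (S w ∧ adj G u w) ≡ S w ∧ (S u ∧ adj G w u)
    induced-sym u w rewrite FinGraph.sym G u w with S u | S w
    ... | true  | true  = refl
    ... | true  | false = refl
    ... | false | true  = refl
    ... | false | false = refl

  neighboursIn : (Vertex → Bool) → Vertex → Vertex → Bool
  neighboursIn S v w = S w ∧ adj G v w

  degIn-induced : ∀ S v → S v ≡ true → degIn (induced S) v ≡ count (neighboursIn S v)
  degIn-induced S v Sv = count-ext _ _ pointwise
    where
    pointwise : ∀ w → S w ∧ (S v ∧ (S w ∧ adj G v w)) ≡ S w ∧ adj G v w
    pointwise w rewrite Sv with S w
    ... | true  = refl
    ... | false = refl

  emptyOrientation : ∀ S → ¬ (∃ λ u → S u ≡ true) → Orientation G d S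
  emptyOrientation S empty = record
    { out = λ _ → [] ; out-small = λ _ → z≤n ; out-adj = λ _ _ ()
    ; out-cover = λ u _ Su _ _ → ⊥-elim (empty (u , Su)) }

  -- Adding back a vertex v with at most d neighbours in S: orient all
  -- its edges inside S away from v.
  addVertex : ∀ S v → S v ≡ true → count (neighboursIn S v) ≤ d →
              Orientation G d (delete S v) → Orientation G d S
  addVertex S v Sv small O = record
    { out = out′ ; out-small = out′-small ; out-adj = out′-adj ; out-cover = out′-cover }
    where
    out′ : Vertex → List Vertex
    out′ = updateAt (out O) v (const (support (neighboursIn S v)))

    out′-v : out′ v ≡ support (neighboursIn S v)
    out′-v = updateAt-updates v (out O)

    out′-other : ∀ u → u ≢ v → out′ u ≡ out O u
    out′-other u u≢v = updateAt-minimal u v (out O) u≢v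

    out′-small : ∀ u → length (out′ u) ≤ d
    out′-small u with u ≟ v
    ... | yes refl rewrite out′-v = ≤-trans (≤-reflexive (length-support (neighboursIn S v))) small
    ... | no u≢v rewrite out′-other u u≢v = out-small O u

    out′-adj : ∀ u w → w ∈ out′ u → adj G u w ≡ true
    out′-adj u w w∈ with u ≟ v
    ... | yes refl rewrite out′-v = proj₂ (∧-elim {S w} (∈-support⁻ _ w w∈))
    ... | no u≢v rewrite out′-other u u≢v = out-adj O u w w∈

    leaves-v : ∀ w → S w ≡ true → adj G v w ≡ true → w ∈ out′ v
    leaves-v w Sw a rewrite out′-v = ∈-support⁺ _ w (∧-intro Sw a)

    kept : ∀ u → S u ≡ true → u ≢ v → delete S v u ≡ true
    kept u Su u≢v = trans (updateAt-minimal u v S u≢v) Su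

    out′-cover : ∀ u w → S u ≡ true → S w ≡ true → adj G u w ≡ true →
                 w ∈ out′ u ⊎ u ∈ out′ w
    out′-cover u w Su Sw a with u ≟ v | w ≟ v
    ... | yes refl | _        = inj₁ (leaves-v w Sw a)
    ... | no _     | yes refl = inj₂ (leaves-v u Su (trans (FinGraph.sym G w u) a))
    ... | no u≢v   | no w≢v
      rewrite out′-other u u≢v | out′-other w w≢v =
      out-cover O u w (kept u Su u≢v) (kept w Sw w≢v) a

  -- Peeling, by induction on an upper bound m for |S|: a degenerate graph
  -- yields a bounded orientation of every induced subgraph.
  peel : Degenerate d G → ∀ m S → count S ≤ m → Orientation G d S
  peel deg m S S≤m with any? (λ u → S u ≟ᵇ true)
  ... | no empty = emptyOrientation S empty
  ... | yes (u , Su) with deg (induced S) (u , Su)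
  ... | v , Sv , degv with m | ≤-trans (≤-reflexive (sym (count-delete S v Sv))) S≤m
  ...   | zero   | ()
  ...   | suc m′ | S′<m =
    addVertex S v Sv (subst (_≤ d) (degIn-induced S v Sv) degv)
      (peel deg m′ (delete S v) (≤-pred S′<m))

  degenerate⇒orientation : Degenerate d G → Orientation G d (const true)
  degenerate⇒orientation deg = peel deg _ (const true) ≤-refl

⋁ : ∀ {m d} → (Fin d → Formula m) → Formula m
⋁ {d = zero}  f = ff′
⋁ {d = suc d} f = or′ (f zero) (⋁ (λ i → f (suc i)))

⋁-sat : ∀ {m d} (f : Fin d → Formula m) ρ → Sat (⋁ f) ρ ⇔ ∃ λ i → Sat (f i) ρ
⋁-sat f ρ = mk⇔ (elim f) (intro f)
  where
  elim : ∀ {d} (f : Fin d → Formula _) → Sat (⋁ f) ρ → ∃ λ i → Sat (f i) ρ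
  elim {suc d} f (inj₁ s) = zero , s
  elim {suc d} f (inj₂ s) with elim (λ i → f (suc i)) s
  ... | i , t = suc i , t
  intro : ∀ {d} (f : Fin d → Formula _) → (∃ λ i → Sat (f i) ρ) → Sat (⋁ f) ρ
  intro f (zero  , s) = inj₁ s
  intro f (suc i , s) = inj₂ (intro (λ j → f (suc j)) (i , s))

arcFormula : ∀ d → Formula (suc d + suc d)
arcFormula d = and′ (not′ (eq′ zero b₀)) (⋁ (λ (i : Fin d) → eq′ (suc i ↑ˡ suc d) b₀))
  where
  b₀ : Fin (suc d + suc d)
  b₀ = suc d ↑ʳ zero

arcFormula-sat : ∀ {d} x (xs : Vec ℕ d) y ys →
  SatPair (arcFormula d) (x ∷ xs) (y ∷ ys) ⇔ (x ≢ y × ∃ λ i → lookup xs i ≡ y)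
arcFormula-sat {d} x xs y ys = mk⇔
  (λ (x≢b₀ , s) → (λ x≡y → x≢b₀ (trans x≡y (sym b₀≡y))) , rewrite-tail (to (⋁-sat _ _) s))
  (λ (x≢y , s) → (λ x≡b₀ → x≢y (trans x≡b₀ b₀≡y)) , from (⋁-sat _ _) (unrewrite-tail s))
  where
  ρ = lookup ((x ∷ xs) ++ (y ∷ ys))
  b₀≡y : ρ (suc d ↑ʳ zero) ≡ y
  b₀≡y = lookup-++ʳ (x ∷ xs) (y ∷ ys) zero
  aᵢ₊₁ : ∀ i → ρ (suc i ↑ˡ suc d) ≡ lookup xs i
  aᵢ₊₁ i = lookup-++ˡ (x ∷ xs) (y ∷ ys) (suc i)
  rewrite-tail : (∃ λ i → ρ (suc i ↑ˡ suc d) ≡ ρ (suc d ↑ʳ zero)) → ∃ λ i → lookup xs i ≡ y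
  rewrite-tail (i , e) = i , trans (sym (aᵢ₊₁ i)) (trans e b₀≡y)
  unrewrite-tail : (∃ λ i → lookup xs i ≡ y) → ∃ λ i → ρ (suc i ↑ˡ suc d) ≡ ρ (suc d ↑ʳ zero)
  unrewrite-tail (i , e) = i , trans (aᵢ₊₁ i) (trans e (sym b₀≡y))

pad : ∀ {A : Set} d → A → List A → Vec A d
pad zero    x ys       = []
pad (suc d) x []       = x ∷ pad d x []
pad (suc d) x (y ∷ ys) = y ∷ pad d x ys

pad-∈ : ∀ {A : Set} d (x y : A) ys → x ≢ y → length ys ≤ d →
        (∃ λ i → lookup (pad d x ys) i ≡ y) ⇔ y ∈ ys
pad-∈ d x y ys x≢y fits = mk⇔ (sound d ys) (complete d ys fits)
  where
  sound : ∀ d ys → (∃ λ i → lookup (pad d x ys) i ≡ y) → y ∈ ys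
  sound (suc d) []       (zero  , x≡y) = ⊥-elim (x≢y x≡y)
  sound (suc d) []       (suc i , e)   = sound d [] (i , e)
  sound (suc d) (_ ∷ ys) (zero  , refl) = here refl
  sound (suc d) (_ ∷ ys) (suc i , e)   = there (sound d ys (i , e))
  complete : ∀ d ys → length ys ≤ d → y ∈ ys → ∃ λ i → lookup (pad d x ys) i ≡ y
  complete (suc d) (_ ∷ ys) _         (here refl) = zero , refl
  complete (suc d) (_ ∷ ys) (s≤s fits) (there y∈) with complete d ys fits y∈
  ... | i , e = suc i , e

∈-map-toℕ : ∀ {n} (v : Fin n) xs → toℕ v ∈ map toℕ xs ⇔ v ∈ xs
∈-map-toℕ v xs = mk⇔ reflect (∈-map⁺ toℕ)
  where
  reflect : toℕ v ∈ map toℕ xs → v ∈ xs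
  reflect v∈ with ∈-map⁻ toℕ v∈
  ... | w , w∈ , e = subst (_∈ xs) (sym (toℕ-injective e)) w∈

module Encoding {G : FinGraph} {d : ℕ} {S : Fin (size G) → Bool} (O : Orientation G d S) where

  code : Fin (size G) → Vec ℕ (suc d)
  code v = toℕ v ∷ pad d (toℕ v) (map toℕ (out O v))

  code-injective : ∀ u v → code u ≡ code v → u ≡ v
  code-injective u v e = toℕ-injective (cong head e)

  code-arc : ∀ u v → u ≢ v → SatPair (arcFormula d) (code u) (code v) ⇔ v ∈ out O u
  code-arc u v u≢v = mk⇔
    (λ s → to listed (to (pad-∈ d _ _ _ u≢v′ fits) (proj₂ (to sat s))))
    (λ v∈ → from sat (u≢v′ , from (pad-∈ d _ _ _ u≢v′ fits) (from listed v∈)))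
    where
    sat    = arcFormula-sat (toℕ u) (pad d (toℕ u) (map toℕ (out O u))) (toℕ v) _
    listed = ∈-map-toℕ v (out O u)
    u≢v′ : toℕ u ≢ toℕ v
    u≢v′ e = u≢v (toℕ-injective e)
    fits : length (map toℕ (out O u)) ≤ d
    fits = ≤-trans (≤-reflexive (length-map toℕ (out O u))) (out-small O u)

orientation⇒embeds : ∀ {G d} → Orientation G d (const true) → EmbedsIn (arcFormula d) G
orientation⇒embeds {G} {d} O = code , code-injective , adjacency
  where
  open Encoding O
  adjacency : ∀ u v → u ≢ v → (adj G u v ≡ true) ⇔ AdjΦ (arcFormula d) (code u) (code v)
  adjacency u v u≢v = mk⇔ arc-exists arc-adjacent
    where
    v≢u : v ≢ u
    v≢u e = u≢v (sym e)
    arc-exists : adj G u v ≡ true → AdjΦ (arcFormula d) (code u) (code v)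
    arc-exists a with out-cover O u v refl refl a
    ... | inj₁ v∈ = inj₁ (from (code-arc u v u≢v) v∈)
    ... | inj₂ u∈ = inj₂ (from (code-arc v u v≢u) u∈)
    arc-adjacent : AdjΦ (arcFormula d) (code u) (code v) → adj G u v ≡ true
    arc-adjacent (inj₁ s) = out-adj O u v (to (code-arc u v u≢v) s)
    arc-adjacent (inj₂ s) =
      trans (FinGraph.sym G u v) (out-adj O v u (to (code-arc v u v≢u) s))

mainTheorem16 : ∀ {ℓ : Level} (C : GraphClass ℓ) → DegenerateClass C → SetDefined C
mainTheorem16 C (d , degenerate) =
  suc d , arcFormula d ,
  λ G G∈C → orientation⇒embeds (Peeling.degenerate⇒orientation G d (degenerate G G∈C))
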